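{- Consider an instance of binary Stochastic Submodular Set Cover with item set $N=\{1,\dots,n\}$, costs $c$, probabilities $p$, goal value $Q$ and utility function $g$. Let $W=\{w\in\{0,1,*\}^n : w_j=* \text{ for exactly one } j\}$, and for $w\in W$ let $j(w)$ be the unique $j$ with $w_j=*$. For $a\in\{0,1\}^n$ and $j\in N$ let $a^j$ be $a$ with its $j$-th coordinate replaced by $*$. Consider the linear program (LP1) with variables $x_w$, $w\in W$: minimize $\sum_{w\in W} c_{j(w)}\,p(w)\,x_w$ subject to $\sum_{j\in N} g_{S,a}(j)\,x_{a^j}\ \ge\ Q-g(S,a)$ for all $a\in\{0,1\}^n$ and $S\subseteq N$, and $x_w\ge 0$ for all $w\in W$. Then the optimal value of LP1 is at most the expected cost of an optimal decision tree (strategy) for this instance.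
   Context: Notation: $N=\{1,\dots,n\}$. A partial assignment is $b\in\{0,1,*\}^n$, $dom(b)=\{i:b_i\ne *\}$. $a\sim b$ ($a$ extends $b$) means $a_i=b_i$ whenever $b_i\ne*$. $b_{x_i\leftarrow l}$ is $b$ with coordinate $i$ set to $l$. For $S\subseteq N$, $b^S$ has $b^S_i=b_i$ for $i\in S$ and $*$ otherwise; $g(S,b)=g(b^S)$ and $g_{S,b}(j)=g(S\cup\{j\},b)-g(S,b)$. $p(b)=\prod_{j\in dom(b)}p(b,j)$ where $p(b,j)=p_j$ if $b_j=1$ and $1-p_j$ otherwise. A utility function $g:\{0,1,*\}^n\to\mathbb{Z}_{\ge0}$ is monotone if $g(b_{x_i\leftarrow l})\ge g(b)$ whenever $b_i=*$, $l\in\{0,1\}$; submodular if $g(b_{x_i\leftarrow l})-g(b)\ge g(b'_{x_i\leftarrow l})-g(b')$ whenever $b'\sim b$, $b_i=b'_i=*$, $l\in\{0,1\}$. Binary Stochastic Submodular Set Cover (SSSC): input is costs $c_j\ge0$, a probability vector $p\in[0,1]^n$, an integer goal value $Q\ge0$, and a monotone submodular utility function $g$ with $g(*,\dots,*)=0$ and $g(x)=Q$ for every $x\in\{0,1\}^n$. Each item $j$ has an unknown state $x_j\in\{0,1\}$, with $x$ drawn from the product distribution $D_p$ ($\Pr[x_j=1]=p_j$). A strategy (decision tree) sequentially and adaptively chooses items to test, paying $c_j$ to observe $x_j$, and stops when the partial assignment $b$ of observed states is a cover, i.e. $g(b)=Q$. Its cost is the expected total cost for $x\sim D_p$; an optimal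 strategy minimizes it.
   Formalization: The costs $c_j$ and the probabilities $p_j$ of the instance are rational numbers. -}

module Defs where

open import Data.Nat as ℕ using (ℕ; zero; suc)
open import Data.Integer using (+_)
open import Data.Fin using (Fin; zero; suc)
open import Data.Vec using (Vec; []; _∷_; lookup; _[_]≔_; map; zipWith; replicate)
open import Data.Bool using (Bool; true; false; if_then_else_)
open import Data.Maybe using (Maybe; just; nothing)
open import Data.List as List using (List)
open import Data.Rational using (ℚ; 0ℚ; 1ℚ; _+_; _*_; _-_; _≤_; _/_)
open import Relation.Binary.PropositionalEquality using (_≡_; _≢_)
open import Data.Product using (_×_)
import Data.Maybe

-- three-valued coordinate: 0, 1 or * (unassigned)
data Tri : Set where
  t0 t1 ⋆ : Tri

PAssign : ℕ → Set
PAssign n = Vec Tri n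

embed : Bool → Tri
embed false = t0
embed true  = t1

total : ∀ {n} → Vec Bool n → PAssign n
total = map embed

allStar : ∀ n → PAssign n
allStar n = replicate n ⋆

set : ∀ {n} → PAssign n → Fin n → Bool → PAssign n
set b i l = b [ i ]≔ embed l

_extends_ : ∀ {n} → PAssign n → PAssign n → Set
a extends b = ∀ i → lookup b i ≢ ⋆ → lookup a i ≡ lookup b i

-- b^S, for S ⊆ N given as its characteristic vector
restrict : ∀ {n} → Vec Bool n → PAssign n → PAssign n
restrict = zipWith (λ s t → if s then t else ⋆)

insert : ∀ {n} → Vec Bool n → Fin n → Vec Bool n
insert S j = S [ j ]≔ true

hole : ∀ {n} → Vec Bool n → Fin n → PAssign n
hole a j = total a [ j ]≔ ⋆

ℕtoℚ : ℕ → ℚ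
ℕtoℚ k = + k / 1

sumFin : ∀ n → (Fin n → ℚ) → ℚ
sumFin zero    f = 0ℚ
sumFin (suc n) f = f zero + sumFin n (λ i → f (suc i))

prodFin : ∀ n → (Fin n → ℚ) → ℚ
prodFin zero    f = 1ℚ
prodFin (suc n) f = f zero * prodFin n (λ i → f (suc i))

sumList : List ℚ → ℚ
sumList = List.foldr _+_ 0ℚ

allPAssign : ∀ n → List (PAssign n)
allPAssign zero    = [] List.∷ List.[]
allPAssign (suc n) =
  List.concatMap (λ v → (t0 ∷ v) List.∷ (t1 ∷ v) List.∷ (⋆ ∷ v) List.∷ List.[]) (allPAssign n)

numStars : ∀ {n} → PAssign n → ℕ
numStars []       = 0
numStars (⋆ ∷ v)  = suc (numStars v)
numStars (t0 ∷ v) = numStars v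
numStars (t1 ∷ v) = numStars v

-- the first (for w ∈ W: the unique) index j with w_j = *
firstStar : ∀ {n} → PAssign n → Maybe (Fin n)
firstStar []      = nothing
firstStar (⋆ ∷ v) = just zero
firstStar (t0 ∷ v) = Data.Maybe.map suc (firstStar v)
firstStar (t1 ∷ v) = Data.Maybe.map suc (firstStar v)

InW : ∀ {n} → PAssign n → Set
InW w = numStars w ≡ 1

record SSSC (n : ℕ) : Set where
  field
    c       : Fin n → ℚ
    c≥0     : ∀ j → 0ℚ ≤ c j
    p       : Fin n → ℚ
    p≥0     : ∀ j → 0ℚ ≤ p j
    p≤1     : ∀ j → p j ≤ 1ℚ
    Q       : ℕ
    g       : PAssign n → ℕ
    monotone   : ∀ (b : PAssign n) i l → lookup b i ≡ ⋆ → g b ℕ.≤ g (set b i l)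
    -- g(b_{i←l}) - g(b) ≥ g(b'_{i←l}) - g(b'), written without subtraction
    submodular : ∀ (b b' : PAssign n) i l → b' extends b → lookup b i ≡ ⋆ → lookup b' i ≡ ⋆ →
                 g (set b' i l) ℕ.+ g b ℕ.≤ g (set b i l) ℕ.+ g b'
    g-empty : g (allStar n) ≡ 0
    g-full  : ∀ (a : Vec Bool n) → g (total a) ≡ Q

module _ {n : ℕ} (I : SSSC n) where
  open SSSC I

  pCoord : Fin n → Tri → ℚ
  pCoord j t0 = 1ℚ - p j
  pCoord j t1 = p j
  pCoord j ⋆  = 1ℚ

  prob : PAssign n → ℚ
  prob b = prodFin n (λ j → pCoord j (lookup b j))

  gS : Vec Bool n → PAssign n → ℕ
  gS S b = g (restrict S b)

  gMarg : Vec Bool n → PAssign n → Fin n → ℚ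
  gMarg S b j = ℕtoℚ (gS (insert S j) b) - ℕtoℚ (gS S b)

  lpTerm : (PAssign n → ℚ) → PAssign n → ℚ
  lpTerm x w with numStars w ℕ.≡ᵇ 1 | firstStar w
  ... | true  | just j = c j * prob w * x w
  ... | _     | _      = 0ℚ

  lpObjective : (PAssign n → ℚ) → ℚ
  lpObjective x = sumList (List.map (lpTerm x) (allPAssign n))

  -- feasibility for LP1 (only the coordinates x_w, w ∈ W, matter)
  LPFeasible : (PAssign n → ℚ) → Set
  LPFeasible x =
    (∀ (a S : Vec Bool n) →
       ℕtoℚ Q - ℕtoℚ (gS S (total a)) ≤ sumFin n (λ j → gMarg S (total a) j * x (hole a j)))
    × (∀ w → InW w → 0ℚ ≤ x w)

  data Tree : Set where
    leaf : Tree
    test : Fin n → Tree → Tree → Tree   -- test item j; left subtree if x_j = 0, right if x_j = 1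

  data Valid : PAssign n → Tree → Set where
    leafV : ∀ {b} → g b ≡ Q → Valid b leaf
    testV : ∀ {b j T0 T1} → g b ≢ Q → lookup b j ≡ ⋆ →
            Valid (set b j false) T0 → Valid (set b j true) T1 → Valid b (test j T0 T1)

  expCost : Tree → ℚ
  expCost leaf = 0ℚ
  expCost (test j T0 T1) = c j + (1ℚ - p j) * expCost T0 + p j * expCost T1

{-# OPTIONS --safe #-}
-- Given a strategy T, put x_w = 1 exactly when the item j(w) left open by w is tested by T on the path
-- determined by w (before j(w) is tested the path only reads coordinates fixed in w), and x_w = 0
-- otherwise. The objective then equals Σ_j c_j Pr[T tests j], the expected cost: splitting the
-- objective sum along the item j tested at the root reproduces the recursion of expCost, because the
-- subtrees never test j again and the assignments whose only unassigned coordinate is j have total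
-- probability 1. For feasibility at (a, S), follow the path of a in T: adding its items to S one at a
-- time raises g(S, a) to Q, as the leaf is a cover and g is monotone, and by submodularity each
-- increment is at most the marginal g_{S,a}(j), which enters the constraint with x_{a^j} = 1.

module Submission where

open import Defs
open import Data.Bool as Bool using (Bool; true; false; if_then_else_)
open import Data.Empty using (⊥-elim)
open import Data.Fin using (Fin; zero; suc; _≟_)
open import Data.Fin.Properties using (suc-injective)
open import Data.Integer using () renaming (+_ to ℤ+_)
import Data.Integer.Properties as ℤ
import Data.List as List
import Data.List.Properties as List
open import Data.Maybe as Maybe using (Maybe; just; nothing; maybe′)
open import Data.Nat as ℕ using (ℕ; zero; suc)
open import Data.Nat.Coprimality using (1-coprimeTo) renaming (sym to coprime-sym)
import Data.Nat.Properties as ℕ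
open import Data.Product using (Σ; _×_; _,_)
open import Data.Rational using (ℚ; 0ℚ; 1ℚ; _+_; _*_; _-_; -_; _≤_; mkℚ)
open import Data.Rational.Properties
  using (≤-refl; ≤-reflexive; +-mono-≤; +-monoˡ-≤; +-monoʳ-≤; *-monoʳ-≤-nonNeg;
         nonNegative⁻¹; normalize-nonNeg; normalize-coprime; +-*-commutativeRing;
         *-zeroˡ; *-zeroʳ; *-identityˡ; *-identityʳ; +-identityˡ; +-identityʳ; +-inverseʳ; +-assoc;
         module ≤-Reasoning)
  renaming (_≟_ to _≟ℚ_)
open import Data.Rational.Base using (nonNegative)
open import Data.Vec using (Vec; []; _∷_; lookup; _[_]≔_)
open import Data.Vec.Properties using (lookup∘update; lookup∘update′; []≔-lookup; lookup-map; lookup-zipWith)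
open import Function using (_∘_)
open import Relation.Binary.PropositionalEquality
open import Relation.Nullary using (yes; no)
open import Relation.Nullary.Decidable using (dec⇒maybe)
open import Tactic.RingSolver using (solve-∀)
open import Tactic.RingSolver.Core.AlmostCommutativeRing using (AlmostCommutativeRing; fromCommutativeRing)

-- with a genuine zero test the solver can cancel terms whose coefficient is 0ℚ
ℚ-ring : AlmostCommutativeRing _ _
ℚ-ring = fromCommutativeRing +-*-commutativeRing (λ x → dec⇒maybe (0ℚ ≟ℚ x))

ℕtoℚ≡mkℚ : ∀ k → ℕtoℚ k ≡ mkℚ (ℤ+ k) 0 (coprime-sym (1-coprimeTo k))
ℕtoℚ≡mkℚ k = normalize-coprime (coprime-sym (1-coprimeTo k))

ℕtoℚ-+ : ∀ m k → ℕtoℚ (m ℕ.+ k) ≡ ℕtoℚ m + ℕtoℚ k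
ℕtoℚ-+ m k rewrite ℕtoℚ≡mkℚ m | ℕtoℚ≡mkℚ k | ℕ.*-identityʳ m | ℕ.*-identityʳ k
  | ℤ.+◃n≡+n m | ℤ.+◃n≡+n k = refl

ℕtoℚ-nonNeg : ∀ k → 0ℚ ≤ ℕtoℚ k
ℕtoℚ-nonNeg k = nonNegative⁻¹ (ℕtoℚ k) {{normalize-nonNeg k 1}}

ℕtoℚ-mono-≤ : ∀ {m k} → m ℕ.≤ k → ℕtoℚ m ≤ ℕtoℚ k
ℕtoℚ-mono-≤ {m} {k} m≤k = begin
  ℕtoℚ m                      ≡⟨ sym (+-identityʳ (ℕtoℚ m)) ⟩
  ℕtoℚ m + 0ℚ                 ≤⟨ +-monoʳ-≤ (ℕtoℚ m) (ℕtoℚ-nonNeg (k ℕ.∸ m)) ⟩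
  ℕtoℚ m + ℕtoℚ (k ℕ.∸ m)     ≡⟨ sym (ℕtoℚ-+ m (k ℕ.∸ m)) ⟩
  ℕtoℚ (m ℕ.+ (k ℕ.∸ m))      ≡⟨ cong ℕtoℚ (ℕ.m+[n∸m]≡n m≤k) ⟩
  ℕtoℚ k                      ∎
  where open ≤-Reasoning

p+s≤r+q⇒p-q≤r-s : ∀ {p q r s} → p + s ≤ r + q → p - q ≤ r - s
p+s≤r+q⇒p-q≤r-s {p} {q} {r} {s} h =
  subst₂ _≤_ (cancelʳ p q s) (cancelˡ r q s) (+-monoˡ-≤ (- (q + s)) h)
  where
  cancelʳ : ∀ x y z → x + z + - (y + z) ≡ x - y
  cancelʳ = solve-∀ ℚ-ring
  cancelˡ : ∀ x y z → x + y + - (y + z) ≡ x - z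
  cancelˡ = solve-∀ ℚ-ring

0*p*q≡0 : ∀ p q → 0ℚ * p * q ≡ 0ℚ
0*p*q≡0 p q = trans (cong (_* q) (*-zeroˡ p)) (*-zeroˡ q)

p≤q⇒p-q≤0 : ∀ {p q} → p ≤ q → p - q ≤ 0ℚ
p≤q⇒p-q≤0 {p} {q} h = subst (p - q ≤_) (+-inverseʳ q) (+-monoˡ-≤ (- q) h)

sumFin-mono : ∀ m {f h : Fin m → ℚ} → (∀ k → f k ≤ h k) → sumFin m f ≤ sumFin m h
sumFin-mono zero    f≤h = ≤-refl
sumFin-mono (suc m) f≤h = +-mono-≤ (f≤h zero) (sumFin-mono m (f≤h ∘ suc))

sumFin-zero : ∀ m {f : Fin m → ℚ} → (∀ k → f k ≡ 0ℚ) → sumFin m f ≡ 0ℚ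
sumFin-zero zero    f≡0 = refl
sumFin-zero (suc m) f≡0 = trans (cong₂ _+_ (f≡0 zero) (sumFin-zero m (f≡0 ∘ suc))) (+-identityʳ 0ℚ)

sumFin-mono-+ : ∀ m (j : Fin m) {f h : Fin m → ℚ} v →
  f j + v ≤ h j → (∀ k → k ≢ j → f k ≤ h k) → sumFin m f + v ≤ sumFin m h
sumFin-mono-+ (suc m) zero {f} {h} v fj+v≤hj f≤h = begin
  f zero + sumFin m (f ∘ suc) + v   ≡⟨ swap (f zero) (sumFin m (f ∘ suc)) v ⟩
  f zero + v + sumFin m (f ∘ suc)   ≤⟨ +-mono-≤ fj+v≤hj (sumFin-mono m (λ k → f≤h (suc k) λ ())) ⟩
  h zero + sumFin m (h ∘ suc)       ∎
  where
  open ≤-Reasoning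
  swap : ∀ x y z → x + y + z ≡ x + z + y
  swap = solve-∀ ℚ-ring
sumFin-mono-+ (suc m) (suc j) {f} {h} v fj+v≤hj f≤h = begin
  f zero + sumFin m (f ∘ suc) + v   ≡⟨ +-assoc (f zero) (sumFin m (f ∘ suc)) v ⟩
  f zero + (sumFin m (f ∘ suc) + v) ≤⟨ +-mono-≤ (f≤h zero λ ()) tail ⟩
  h zero + sumFin m (h ∘ suc)       ∎
  where
  open ≤-Reasoning
  tail : sumFin m (f ∘ suc) + v ≤ sumFin m (h ∘ suc)
  tail = sumFin-mono-+ m j v fj+v≤hj (λ k k≢j → f≤h (suc k) (k≢j ∘ suc-injective))

sumList-++ : ∀ xs ys → sumList (xs List.++ ys) ≡ sumList xs + sumList ys
sumList-++ List.[]       ys = sym (+-identityˡ _)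
sumList-++ (x List.∷ xs) ys = trans (cong (x +_) (sumList-++ xs ys)) (sym (+-assoc x _ _))

sumList-concatMap : ∀ {A B : Set} (f : A → ℚ) (h : B → List.List A) xs →
  sumList (List.map f (List.concatMap h xs)) ≡ sumList (List.map (λ v → sumList (List.map f (h v))) xs)
sumList-concatMap f h List.[]       = refl
sumList-concatMap f h (x List.∷ xs) = begin
  sumList (List.map f (h x List.++ List.concatMap h xs))               ≡⟨ cong sumList (List.map-++ f (h x) _) ⟩
  sumList (List.map f (h x) List.++ List.map f (List.concatMap h xs))  ≡⟨ sumList-++ (List.map f (h x)) _ ⟩
  sumList (List.map f (h x)) + sumList (List.map f (List.concatMap h xs)) ≡⟨ cong (sumList (List.map f (h x)) +_) (sumList-concatMap f h xs) ⟩
  _ ∎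
  where open ≡-Reasoning

sumList-map-+ : ∀ {A : Set} (f h : A → ℚ) xs →
  sumList (List.map (λ x → f x + h x) xs) ≡ sumList (List.map f xs) + sumList (List.map h xs)
sumList-map-+ f h List.[]       = sym (+-identityʳ 0ℚ)
sumList-map-+ f h (x List.∷ xs) =
  trans (cong (f x + h x +_) (sumList-map-+ f h xs)) (interchange (f x) (h x) _ _)
  where
  interchange : ∀ a b c d → a + b + (c + d) ≡ a + c + (b + d)
  interchange = solve-∀ ℚ-ring

sumList-map-*ˡ : ∀ {A : Set} (a : ℚ) (f : A → ℚ) xs →
  sumList (List.map (λ x → a * f x) xs) ≡ a * sumList (List.map f xs)
sumList-map-*ˡ a f List.[]       = sym (*-zeroʳ a)
sumList-map-*ˡ a f (x List.∷ xs) = trans (cong (a * f x +_) (sumList-map-*ˡ a f xs)) (distrib a (f x) _)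
  where
  distrib : ∀ a b c → a * b + a * c ≡ a * (b + c)
  distrib = solve-∀ ℚ-ring

Σᴾ : ∀ n → (PAssign n → ℚ) → ℚ
Σᴾ n f = sumList (List.map f (allPAssign n))

Σᴾ-suc : ∀ {n} (f : PAssign (suc n) → ℚ) →
  Σᴾ (suc n) f ≡ Σᴾ n (λ v → f (t0 ∷ v) + (f (t1 ∷ v) + (f (⋆ ∷ v) + 0ℚ)))
Σᴾ-suc {n} f = sumList-concatMap f _ (allPAssign n)

Σᴾ-cong : ∀ {n} {f h : PAssign n → ℚ} → (∀ w → f w ≡ h w) → Σᴾ n f ≡ Σᴾ n h
Σᴾ-cong {n} f≡h = cong sumList (List.map-cong f≡h (allPAssign n))

Σᴾ-zero : ∀ {n} {f : PAssign n → ℚ} → (∀ w → f w ≡ 0ℚ) → Σᴾ n f ≡ 0ℚ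
Σᴾ-zero {n} {f} f≡0 = go (allPAssign n)
  where
  go : ∀ ws → sumList (List.map f ws) ≡ 0ℚ
  go List.[]       = refl
  go (w List.∷ ws) = trans (cong₂ _+_ (f≡0 w) (go ws)) (+-identityʳ 0ℚ)

isStar : Tri → ℚ
isStar t0 = 0ℚ
isStar t1 = 0ℚ
isStar ⋆  = 1ℚ

Σ⋆ : ∀ {n} → Fin n → (PAssign n → ℚ) → ℚ
Σ⋆ {n} j f = Σᴾ n (λ w → isStar (lookup w j) * f w)

fiber : ∀ {n} → (PAssign n → ℚ) → Fin n → PAssign n → ℚ
fiber f j w = f (w [ j ]≔ t0) + (f (w [ j ]≔ t1) + f w)

Σᴾ-split : ∀ {n} (j : Fin n) (f : PAssign n → ℚ) → Σᴾ n f ≡ Σ⋆ j (fiber f j)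
Σᴾ-split {suc m} zero f = begin
  Σᴾ (suc m) f                                                             ≡⟨ Σᴾ-suc f ⟩
  Σᴾ m (λ v → f (t0 ∷ v) + (f (t1 ∷ v) + (f (⋆ ∷ v) + 0ℚ)))               ≡⟨ Σᴾ-cong (λ v → regroup (f (t0 ∷ v)) (f (t1 ∷ v)) (f (⋆ ∷ v))) ⟩
  Σᴾ m (λ v → h (t0 ∷ v) + (h (t1 ∷ v) + (h (⋆ ∷ v) + 0ℚ)))               ≡⟨ Σᴾ-suc h ⟨
  Σ⋆ zero (fiber f zero)                                                   ∎
  where
  open ≡-Reasoning
  h : PAssign (suc m) → ℚ
  h w = isStar (lookup w zero) * fiber f zero w
  regroup : ∀ a b c → a + (b + (c + 0ℚ)) ≡ 0ℚ * (a + (b + a)) + (0ℚ * (a + (b + b)) + (1ℚ * (a + (b + c)) + 0ℚ))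
  regroup = solve-∀ ℚ-ring
Σᴾ-split {suc m} (suc j) f = begin
  Σᴾ (suc m) f                                                 ≡⟨ Σᴾ-suc f ⟩
  Σᴾ m f′                                                      ≡⟨ Σᴾ-split j f′ ⟩
  Σ⋆ j (fiber f′ j)                                            ≡⟨ Σᴾ-cong regroup-at ⟩
  Σᴾ m (λ v → h (t0 ∷ v) + (h (t1 ∷ v) + (h (⋆ ∷ v) + 0ℚ)))   ≡⟨ Σᴾ-suc h ⟨
  Σ⋆ (suc j) (fiber f (suc j))                                 ∎
  where
  open ≡-Reasoning
  f′ : PAssign m → ℚ
  f′ v = f (t0 ∷ v) + (f (t1 ∷ v) + (f (⋆ ∷ v) + 0ℚ))
  h : PAssign (suc m) → ℚ
  h w = isStar (lookup w (suc j)) * fiber f (suc j) w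
  regroup : ∀ i a₀ a₁ a b₀ b₁ b c₀ c₁ c →
    i * ((a₀ + (b₀ + (c₀ + 0ℚ))) + ((a₁ + (b₁ + (c₁ + 0ℚ))) + (a + (b + (c + 0ℚ))))) ≡
    i * (a₀ + (a₁ + a)) + (i * (b₀ + (b₁ + b)) + (i * (c₀ + (c₁ + c)) + 0ℚ))
  regroup = solve-∀ ℚ-ring
  regroup-at : ∀ v → isStar (lookup v j) * fiber f′ j v ≡ h (t0 ∷ v) + (h (t1 ∷ v) + (h (⋆ ∷ v) + 0ℚ))
  regroup-at v = regroup (isStar (lookup v j))
    (f (t0 ∷ (v [ j ]≔ t0))) (f (t0 ∷ (v [ j ]≔ t1))) (f (t0 ∷ v))
    (f (t1 ∷ (v [ j ]≔ t0))) (f (t1 ∷ (v [ j ]≔ t1))) (f (t1 ∷ v))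
    (f (⋆ ∷ (v [ j ]≔ t0)))  (f (⋆ ∷ (v [ j ]≔ t1)))  (f (⋆ ∷ v))

Σ⋆-cong : ∀ {n} (j : Fin n) {f h : PAssign n → ℚ} → (∀ w → lookup w j ≡ ⋆ → f w ≡ h w) → Σ⋆ j f ≡ Σ⋆ j h
Σ⋆-cong j {f} {h} f≡h = Σᴾ-cong pointwise
  where
  pointwise : ∀ w → isStar (lookup w j) * f w ≡ isStar (lookup w j) * h w
  pointwise w with lookup w j in e
  ... | t0 = trans (*-zeroˡ (f w)) (sym (*-zeroˡ (h w)))
  ... | t1 = trans (*-zeroˡ (f w)) (sym (*-zeroˡ (h w)))
  ... | ⋆  = cong (1ℚ *_) (f≡h w e)

Σ⋆-linear : ∀ {n} (j : Fin n) a b c (f₀ f₁ f₂ : PAssign n → ℚ) →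
  Σ⋆ j (λ w → a * f₀ w + (b * f₁ w + c * f₂ w)) ≡ a * Σ⋆ j f₀ + (b * Σ⋆ j f₁ + c * Σ⋆ j f₂)
Σ⋆-linear {n} j a b c f₀ f₁ f₂ = begin
  Σ⋆ j (λ w → a * f₀ w + (b * f₁ w + c * f₂ w))                            ≡⟨ Σᴾ-cong (λ w → distrib (ι w) a b c (f₀ w) (f₁ w) (f₂ w)) ⟩
  Σᴾ n (λ w → a * (ι w * f₀ w) + (b * (ι w * f₁ w) + c * (ι w * f₂ w)))    ≡⟨ sumList-map-+ _ _ ws ⟩
  Σᴾ n (λ w → a * (ι w * f₀ w)) + Σᴾ n (λ w → b * (ι w * f₁ w) + c * (ι w * f₂ w))
    ≡⟨ cong₂ _+_ (sumList-map-*ˡ a _ ws) (trans (sumList-map-+ _ _ ws) (cong₂ _+_ (sumList-map-*ˡ b _ ws) (sumList-map-*ˡ c _ ws))) ⟩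
  a * Σ⋆ j f₀ + (b * Σ⋆ j f₁ + c * Σ⋆ j f₂)                                ∎
  where
  open ≡-Reasoning
  ws = allPAssign n
  ι : PAssign n → ℚ
  ι w = isStar (lookup w j)
  distrib : ∀ i a b c x y z → i * (a * x + (b * y + c * z)) ≡ a * (i * x) + (b * (i * y) + c * (i * z))
  distrib = solve-∀ ℚ-ring

weight : ∀ {n} → (Fin n → Tri → ℚ) → PAssign n → ℚ
weight {n} q b = prodFin n (λ j → q j (lookup b j))

indicator : Bool → ℚ
indicator true  = 1ℚ
indicator false = 0ℚ

isTotal : ∀ {n} → PAssign n → ℚ
isTotal w = indicator (numStars w ℕ.≡ᵇ 0)

isInW : ∀ {n} → PAssign n → ℚ
isInW w = indicator (numStars w ℕ.≡ᵇ 1)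

star⇒numStars≢0 : ∀ {m} (v : PAssign m) j → lookup v j ≡ ⋆ → numStars v ≢ 0
star⇒numStars≢0 (⋆  ∷ v) j       e ()
star⇒numStars≢0 (t0 ∷ v) (suc j) e = star⇒numStars≢0 v j e
star⇒numStars≢0 (t1 ∷ v) (suc j) e = star⇒numStars≢0 v j e

isStar*isTotal : ∀ {m} (v : PAssign m) j → isStar (lookup v j) * isTotal v ≡ 0ℚ
isStar*isTotal v j with lookup v j in e
... | t0 = *-zeroˡ (isTotal v)
... | t1 = *-zeroˡ (isTotal v)
... | ⋆ with numStars v in ns
...   | zero  = ⊥-elim (star⇒numStars≢0 v j e ns)
...   | suc _ = *-zeroʳ 1ℚ

weight-update : ∀ {n} (q : Fin n → Tri → ℚ) → (∀ j → q j ⋆ ≡ 1ℚ) →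
  ∀ w j t → weight q (w [ j ]≔ t) ≡ q j t * weight q (w [ j ]≔ ⋆)
weight-update q q⋆≡1 (x ∷ w) zero    t =
  cong (q zero t *_) (sym (trans (cong (_* weight (q ∘ suc) w) (q⋆≡1 zero)) (*-identityˡ (weight (q ∘ suc) w))))
weight-update q q⋆≡1 (x ∷ w) (suc j) t =
  trans (cong (q zero x *_) (weight-update (q ∘ suc) (q⋆≡1 ∘ suc) w j t)) (swap (q zero x) (q (suc j) t) _)
  where
  swap : ∀ a b c → a * (b * c) ≡ b * (a * c)
  swap = solve-∀ ℚ-ring

mass-total : ∀ {n} (q : Fin n → Tri → ℚ) → (∀ j → q j t0 + q j t1 ≡ 1ℚ) →
  Σᴾ n (λ w → isTotal w * weight q w) ≡ 1ℚ
mass-total {zero}  q coin = refl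
mass-total {suc n} q coin =
  trans (Σᴾ-suc (λ w → isTotal w * weight q w)) (trans (Σᴾ-cong step) (mass-total (q ∘ suc) (coin ∘ suc)))
  where
  W = weight (q ∘ suc)
  regroup : ∀ z a b x P → z * (a * P) + (z * (b * P) + (0ℚ * x + 0ℚ)) ≡ (a + b) * (z * P)
  regroup = solve-∀ ℚ-ring
  step : ∀ v → isTotal v * (q zero t0 * W v) + (isTotal v * (q zero t1 * W v) + (0ℚ * (q zero ⋆ * W v) + 0ℚ))
             ≡ isTotal v * W v
  step v = trans (regroup (isTotal v) (q zero t0) (q zero t1) (q zero ⋆ * W v) (W v))
                 (trans (cong (_* (isTotal v * W v)) (coin zero)) (*-identityˡ (isTotal v * W v)))

mass-onlyStar : ∀ {n} (q : Fin n → Tri → ℚ) → (∀ j → q j t0 + q j t1 ≡ 1ℚ) → (∀ j → q j ⋆ ≡ 1ℚ) →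
  ∀ j → Σ⋆ j (λ w → isInW w * weight q w) ≡ 1ℚ
mass-onlyStar {suc n} q coin q⋆≡1 zero =
  trans (Σᴾ-suc (λ w → isStar (lookup w zero) * (isInW w * weight q w)))
    (trans (Σᴾ-cong step) (mass-total (q ∘ suc) (coin ∘ suc)))
  where
  W = weight (q ∘ suc)
  regroup : ∀ x y z s P → 0ℚ * x + (0ℚ * y + (1ℚ * (z * (s * P)) + 0ℚ)) ≡ s * (z * P)
  regroup = solve-∀ ℚ-ring
  step : ∀ v → 0ℚ * (isInW v * (q zero t0 * W v)) + (0ℚ * (isInW v * (q zero t1 * W v))
                 + (1ℚ * (isTotal v * (q zero ⋆ * W v)) + 0ℚ)) ≡ isTotal v * W v
  step v = trans (regroup (isInW v * (q zero t0 * W v)) (isInW v * (q zero t1 * W v)) (isTotal v) (q zero ⋆) (W v))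
                 (trans (cong (_* (isTotal v * W v)) (q⋆≡1 zero)) (*-identityˡ (isTotal v * W v)))
mass-onlyStar {suc n} q coin q⋆≡1 (suc j) =
  trans (Σᴾ-suc (λ w → isStar (lookup w (suc j)) * (isInW w * weight q w)))
    (trans (Σᴾ-cong step) (mass-onlyStar (q ∘ suc) (coin ∘ suc) (q⋆≡1 ∘ suc) j))
  where
  W = weight (q ∘ suc)
  regroup : ∀ i w z a b s P →
    i * (w * (a * P)) + (i * (w * (b * P)) + (i * (z * (s * P)) + 0ℚ)) ≡ (a + b) * (i * (w * P)) + i * z * (s * P)
  regroup = solve-∀ ℚ-ring
  step : ∀ v → let i = isStar (lookup v j) in
    i * (isInW v * (q zero t0 * W v)) + (i * (isInW v * (q zero t1 * W v)) + (i * (isTotal v * (q zero ⋆ * W v)) + 0ℚ))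
      ≡ i * (isInW v * W v)
  step v = begin
    i * (isInW v * (a * W v)) + (i * (isInW v * (b * W v)) + (i * (isTotal v * (s * W v)) + 0ℚ))
                                          ≡⟨ regroup i (isInW v) (isTotal v) a b s (W v) ⟩
    (a + b) * X + i * isTotal v * (s * W v) ≡⟨ cong₂ (λ u z → u * X + z * (s * W v)) (coin zero) (isStar*isTotal v j) ⟩
    1ℚ * X + 0ℚ * (s * W v)                ≡⟨ cong₂ _+_ (*-identityˡ X) (*-zeroˡ (s * W v)) ⟩
    X + 0ℚ                                 ≡⟨ +-identityʳ X ⟩
    X                                      ∎
    where
    open ≡-Reasoning
    i = isStar (lookup v j)
    a = q zero t0
    b = q zero t1
    s = q zero ⋆
    X = i * (isInW v * W v)

embed≢⋆ : ∀ l → embed l ≢ ⋆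
embed≢⋆ false ()
embed≢⋆ true  ()

update-⋆ : ∀ {m} {w : PAssign m} {j} → lookup w j ≡ ⋆ → w [ j ]≔ ⋆ ≡ w
update-⋆ {w = w} {j} e = trans (cong (w [ j ]≔_) (sym e)) ([]≔-lookup w j)

numStars-set : ∀ {m} (w : PAssign m) j l → numStars (set w j l) ≡ numStars (set w j false)
numStars-set (x  ∷ w) zero    false = refl
numStars-set (x  ∷ w) zero    true  = refl
numStars-set (t0 ∷ w) (suc j) l     = numStars-set w j l
numStars-set (t1 ∷ w) (suc j) l     = numStars-set w j l
numStars-set (⋆  ∷ w) (suc j) l     = cong suc (numStars-set w j l)

firstStar-set : ∀ {m} (w : PAssign m) j l → firstStar (set w j l) ≡ firstStar (set w j false)
firstStar-set (x  ∷ w) zero    false = refl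
firstStar-set (x  ∷ w) zero    true  = refl
firstStar-set (t0 ∷ w) (suc j) l     = cong (Maybe.map suc) (firstStar-set w j l)
firstStar-set (t1 ∷ w) (suc j) l     = cong (Maybe.map suc) (firstStar-set w j l)
firstStar-set (⋆  ∷ w) (suc j) l     = refl

firstStar-star : ∀ {m} (w : PAssign m) {k} → firstStar w ≡ just k → lookup w k ≡ ⋆
firstStar-star (⋆  ∷ w) refl = refl
firstStar-star (t0 ∷ w) e with firstStar w in e′
firstStar-star (t0 ∷ w) refl | just k = firstStar-star w e′
firstStar-star (t1 ∷ w) e with firstStar w in e′
firstStar-star (t1 ∷ w) refl | just k = firstStar-star w e′

firstStar-unique : ∀ {m} (w : PAssign m) j → lookup w j ≡ ⋆ → numStars w ≡ 1 → firstStar w ≡ just j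
firstStar-unique (⋆  ∷ w) zero    _ _  = refl
firstStar-unique (⋆  ∷ w) (suc j) e ns = ⊥-elim (star⇒numStars≢0 w j e (ℕ.suc-injective ns))
firstStar-unique (t0 ∷ w) (suc j) e ns = cong (Maybe.map suc) (firstStar-unique w j e ns)
firstStar-unique (t1 ∷ w) (suc j) e ns = cong (Maybe.map suc) (firstStar-unique w j e ns)

firstStar-hole : ∀ {m} (a : Vec Bool m) k → firstStar (hole a k) ≡ just k
firstStar-hole (x     ∷ a) zero    = refl
firstStar-hole (false ∷ a) (suc k) = cong (Maybe.map suc) (firstStar-hole a k)
firstStar-hole (true  ∷ a) (suc k) = cong (Maybe.map suc) (firstStar-hole a k)

lookup-hole : ∀ {m} (a : Vec Bool m) {k j} → j ≢ k → lookup (hole a k) j ≡ embed (lookup a j)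
lookup-hole a {k} {j} j≢k = trans (lookup∘update′ j≢k (total a) ⋆) (lookup-map j embed a)

lookup-restrict : ∀ {m} (S : Vec Bool m) (b : PAssign m) i → lookup (restrict S b) i ≡ (if lookup S i then lookup b i else ⋆)
lookup-restrict S b i = lookup-zipWith _ i S b

lookup-restrict-∉ : ∀ {m} {S : Vec Bool m} (b : PAssign m) {i} → lookup S i ≡ false → lookup (restrict S b) i ≡ ⋆
lookup-restrict-∉ {S = S} b {i} Si = trans (lookup-restrict S b i) (cong (if_then lookup b i else ⋆) Si)

lookup-restrict-∈ : ∀ {m} {S : Vec Bool m} (b : PAssign m) {i} → lookup S i ≡ true → lookup (restrict S b) i ≡ lookup b i
lookup-restrict-∈ {S = S} b {i} Si = trans (lookup-restrict S b i) (cong (if_then lookup b i else ⋆) Si)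

restrict-insert : ∀ {m} (S : Vec Bool m) (b : PAssign m) j → restrict (insert S j) b ≡ restrict S b [ j ]≔ lookup b j
restrict-insert (s ∷ S) (x ∷ b) zero    = refl
restrict-insert (s ∷ S) (x ∷ b) (suc j) = cong (_ ∷_) (restrict-insert S b j)

restrict-insert-total : ∀ {m} (S a : Vec Bool m) j → restrict (insert S j) (total a) ≡ set (restrict S (total a)) j (lookup a j)
restrict-insert-total S a j = trans (restrict-insert S (total a) j) (cong (restrict S (total a) [ j ]≔_) (lookup-map j embed a))

restrict-insert-∈ : ∀ {m} (S : Vec Bool m) (b : PAssign m) {j} → lookup S j ≡ true → restrict (insert S j) b ≡ restrict S b
restrict-insert-∈ S b {j} Sj =
  trans (restrict-insert S b j) (trans (cong (restrict S b [ j ]≔_) (sym (lookup-restrict-∈ {S = S} b Sj))) ([]≔-lookup _ j))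

restrict-insert-extends : ∀ {m} (S : Vec Bool m) (b : PAssign m) j → restrict (insert S j) b extends restrict S b
restrict-insert-extends (true  ∷ S) (x ∷ b) zero    zero    _ = refl
restrict-insert-extends (false ∷ S) (x ∷ b) zero    zero    h = ⊥-elim (h refl)
restrict-insert-extends (s     ∷ S) (x ∷ b) zero    (suc i) _ = refl
restrict-insert-extends (s     ∷ S) (x ∷ b) (suc j) zero    _ = refl
restrict-insert-extends (s     ∷ S) (x ∷ b) (suc j) (suc i) h = restrict-insert-extends S b j i h

infix 4 _⊑_
data _⊑_ : ∀ {m} → PAssign m → PAssign m → Set where
  ⊑-[]   : [] ⊑ []
  ⊑-keep : ∀ {m t} {v v′ : PAssign m} → v ⊑ v′ → t ∷ v ⊑ t ∷ v′
  ⊑-fill : ∀ {m t} {v v′ : PAssign m} → v ⊑ v′ → ⋆ ∷ v ⊑ t ∷ v′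

allStar-⊑ : ∀ {m} (v : PAssign m) → allStar m ⊑ v
allStar-⊑ []      = ⊑-[]
allStar-⊑ (x ∷ v) = ⊑-fill (allStar-⊑ v)

⊑-update : ∀ {m} {b b′ : PAssign m} j t → b ⊑ b′ → b [ j ]≔ t ⊑ b′ [ j ]≔ t
⊑-update zero    t (⊑-keep b⊑) = ⊑-keep b⊑
⊑-update zero    t (⊑-fill b⊑) = ⊑-keep b⊑
⊑-update (suc j) t (⊑-keep b⊑) = ⊑-keep (⊑-update j t b⊑)
⊑-update (suc j) t (⊑-fill b⊑) = ⊑-fill (⊑-update j t b⊑)

⊑-branch : ∀ {m} {b : PAssign m} {a S j l} → b ⊑ restrict S (total a) → lookup a j ≡ l →
  set b j l ⊑ restrict (insert S j) (total a)
⊑-branch {b = b} {a} {S} {j} {l} b⊑ aj =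
  subst (set b j l ⊑_) (sym (trans (restrict-insert-total S a j) (cong (set (restrict S (total a)) j) aj)))
    (⊑-update j (embed l) b⊑)

Monotone : ∀ {m} → (PAssign m → ℕ) → Set
Monotone {m} f = ∀ (b : PAssign m) i l → lookup b i ≡ ⋆ → f b ℕ.≤ f (set b i l)

monotone-⊑ : ∀ {m} (f : PAssign m → ℕ) → Monotone f → ∀ {b b′} → b ⊑ b′ → f b ℕ.≤ f b′
monotone-⊑ f mono ⊑-[] = ℕ.≤-refl
monotone-⊑ f mono (⊑-keep {t = t} b⊑) = monotone-⊑ (λ v → f (t ∷ v)) (λ v i → mono (t ∷ v) (suc i)) b⊑
monotone-⊑ f mono (⊑-fill {t = t} {v′ = v′} b⊑) =
  ℕ.≤-trans (monotone-⊑ (λ v → f (⋆ ∷ v)) (λ v i → mono (⋆ ∷ v) (suc i)) b⊑) (fill-head t)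
  where
  fill-head : ∀ t → f (⋆ ∷ v′) ℕ.≤ f (t ∷ v′)
  fill-head t0 = mono (⋆ ∷ v′) zero false refl
  fill-head t1 = mono (⋆ ∷ v′) zero true refl
  fill-head ⋆  = ℕ.≤-refl

-- The LP point of a strategy

follow : Tri → ℚ → ℚ → ℚ
follow t0 u v = u
follow t1 u v = v
follow ⋆  u v = 0ℚ

follow-0 : ∀ t → follow t 0ℚ 0ℚ ≡ 0ℚ
follow-0 t0 = refl
follow-0 t1 = refl
follow-0 ⋆  = refl

follow-cong : ∀ {t t′ u u′ v v′} → t ≡ t′ → u ≡ u′ → v ≡ v′ → follow t u v ≡ follow t′ u′ v′
follow-cong refl refl refl = refl

module _ {n : ℕ} (I : SSSC n) where
  open SSSC I

  data Avoids (j : Fin n) : Tree I → Set where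
    avoids-leaf : Avoids j leaf
    avoids-test : ∀ {k T₀ T₁} → k ≢ j → Avoids j T₀ → Avoids j T₁ → Avoids j (test k T₀ T₁)

  -- 1 if T, reading only the coordinates assigned in w, tests k before it meets an unassigned one;
  -- the LP point of T is x_w = testsAlong T j(w) w
  testsAlong : Tree I → Fin n → PAssign n → ℚ
  testsAlong leaf           k w = 0ℚ
  testsAlong (test j T₀ T₁) k w with j ≟ k
  ... | yes _ = 1ℚ
  ... | no  _ = follow (lookup w j) (testsAlong T₀ k w) (testsAlong T₁ k w)

  solution : Tree I → PAssign n → ℚ
  solution T w = maybe′ (λ k → testsAlong T k w) 0ℚ (firstStar w)

  testsAlong-nonNeg : ∀ T k w → 0ℚ ≤ testsAlong T k w
  testsAlong-nonNeg leaf           k w = ≤-refl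
  testsAlong-nonNeg (test j T₀ T₁) k w with j ≟ k
  ... | yes _ = nonNegative⁻¹ 1ℚ
  ... | no  _ with lookup w j
  ...   | t0 = testsAlong-nonNeg T₀ k w
  ...   | t1 = testsAlong-nonNeg T₁ k w
  ...   | ⋆  = ≤-refl

  solution-nonNeg : ∀ T w → 0ℚ ≤ solution T w
  solution-nonNeg T w with firstStar w
  ... | just k  = testsAlong-nonNeg T k w
  ... | nothing = ≤-refl

  solution-leaf : ∀ w → solution leaf w ≡ 0ℚ
  solution-leaf w with firstStar w
  ... | just k  = refl
  ... | nothing = refl

  testsAlong-self : ∀ j T₀ T₁ w → testsAlong (test j T₀ T₁) j w ≡ 1ℚ
  testsAlong-self j T₀ T₁ w with j ≟ j
  ... | yes _  = refl
  ... | no j≢j = ⊥-elim (j≢j refl)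

  solution-hole : ∀ j T₀ T₁ a → solution (test j T₀ T₁) (hole a j) ≡ 1ℚ
  solution-hole j T₀ T₁ a =
    trans (cong (maybe′ (λ k → testsAlong (test j T₀ T₁) k (hole a j)) 0ℚ) (firstStar-hole a j))
          (testsAlong-self j T₀ T₁ (hole a j))

  solution-test : ∀ {j T₀ T₁ w} l → lookup w j ≡ embed l →
    solution (test j T₀ T₁) w ≡ solution (if l then T₁ else T₀) w
  solution-test {j} {T₀} {T₁} {w} l e with firstStar w in f
  ... | nothing = refl
  ... | just k with j ≟ k
  ...   | yes refl = ⊥-elim (embed≢⋆ l (trans (sym e) (firstStar-star w f)))
  ...   | no  _ rewrite e with l
  ...     | false = refl
  ...     | true  = refl

  valid⇒avoids : ∀ {b T} → Valid I b T → ∀ {j} → lookup b j ≢ ⋆ → Avoids j T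
  valid⇒avoids (leafV _) bj≢⋆ = avoids-leaf
  valid⇒avoids (testV {b} {k} _ bk≡⋆ V₀ V₁) {j} bj≢⋆ with k ≟ j
  ... | yes refl = ⊥-elim (bj≢⋆ bk≡⋆)
  ... | no  k≢j  = avoids-test k≢j (valid⇒avoids V₀ (still false)) (valid⇒avoids V₁ (still true))
    where
    still : ∀ l → lookup (set b k l) j ≢ ⋆
    still l = bj≢⋆ ∘ trans (sym (lookup∘update′ (k≢j ∘ sym) b (embed l)))

  testsAlong-avoided : ∀ {j T} → Avoids j T → ∀ w → testsAlong T j w ≡ 0ℚ
  testsAlong-avoided avoids-leaf w = refl
  testsAlong-avoided {j} (avoids-test {k} k≢j A₀ A₁) w with k ≟ j
  ... | yes k≡j = ⊥-elim (k≢j k≡j)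
  ... | no  _ = trans (follow-cong {t = lookup w k} refl (testsAlong-avoided A₀ w) (testsAlong-avoided A₁ w)) (follow-0 (lookup w k))

  testsAlong-local : ∀ {j T} → Avoids j T → ∀ k {w w′} →
    (∀ i → i ≢ j → lookup w i ≡ lookup w′ i) → testsAlong T k w ≡ testsAlong T k w′
  testsAlong-local avoids-leaf k w≈w′ = refl
  testsAlong-local (avoids-test {k′} k′≢j A₀ A₁) k w≈w′ with k′ ≟ k
  ... | yes _ = refl
  ... | no  _ = follow-cong (w≈w′ k′ k′≢j) (testsAlong-local A₀ k w≈w′) (testsAlong-local A₁ k w≈w′)

  solution-set : ∀ {j T} → Avoids j T → ∀ w l → solution T (set w j l) ≡ solution T (set w j false)
  solution-set {j} {T} A w l rewrite firstStar-set w j l with firstStar (set w j false)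
  ... | nothing = refl
  ... | just k  = testsAlong-local A k λ i i≢j →
    trans (lookup∘update′ i≢j w (embed l)) (sym (lookup∘update′ i≢j w t0))

  -- Objective value

  unitCostOf : Bool → Maybe (Fin n) → ℚ
  unitCostOf true (just j) = c j
  unitCostOf _    _        = 0ℚ

  unitCost : PAssign n → ℚ
  unitCost w = unitCostOf (numStars w ℕ.≡ᵇ 1) (firstStar w)

  lpTerm-unitCost : ∀ x w → lpTerm I x w ≡ unitCost w * prob I w * x w
  lpTerm-unitCost x w with numStars w ℕ.≡ᵇ 1 | firstStar w
  ... | true  | just j  = refl
  ... | true  | nothing = sym (0*p*q≡0 (prob I w) (x w))
  ... | false | _       = sym (0*p*q≡0 (prob I w) (x w))

  unitCost-set : ∀ w j l → unitCost (set w j l) ≡ unitCost (set w j false)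
  unitCost-set w j l = cong₂ unitCostOf (cong (ℕ._≡ᵇ 1) (numStars-set w j l)) (firstStar-set w j l)

  unitCost*solution : ∀ T {w j} → lookup w j ≡ ⋆ → unitCost w * solution T w ≡ c j * (isInW w * testsAlong T j w)
  unitCost*solution T {w} {j} e with numStars w ℕ.≡ᵇ 1 in ns
  ... | false = trans (*-zeroˡ (solution T w)) (sym (trans (cong (c j *_) (*-zeroˡ (testsAlong T j w))) (*-zeroʳ (c j))))
  ... | true rewrite firstStar-unique w j e (ℕ.≡ᵇ⇒≡ (numStars w) 1 (subst Bool.T (sym ns) _)) =
    cong (c j *_) (sym (*-identityˡ (testsAlong T j w)))

  prob-set : ∀ {w j} → lookup w j ≡ ⋆ → ∀ l → prob I (set w j l) ≡ pCoord I j (embed l) * prob I w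
  prob-set {w} {j} e l =
    trans (weight-update (pCoord I) (λ _ → refl) w j (embed l)) (cong (λ v → pCoord I j (embed l) * prob I v) (update-⋆ {w = w} e))

  lpTerm-cong : ∀ x x′ w → x w ≡ x′ w → lpTerm I x w ≡ lpTerm I x′ w
  lpTerm-cong x x′ w e =
    trans (lpTerm-unitCost x w) (trans (cong (unitCost w * prob I w *_) e) (sym (lpTerm-unitCost x′ w)))

  fillTerm : Tree I → Fin n → PAssign n → ℚ
  fillTerm T j w = unitCost (set w j false) * prob I w * solution T (set w j false)

  lpTerm-fill : ∀ {j T w} → Avoids j T → lookup w j ≡ ⋆ → ∀ l →
    lpTerm I (solution T) (set w j l) ≡ pCoord I j (embed l) * fillTerm T j w
  lpTerm-fill {j} {T} {w} A e l = begin
    lpTerm I (solution T) (set w j l)                                  ≡⟨ lpTerm-unitCost (solution T) (set w j l) ⟩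
    unitCost (set w j l) * prob I (set w j l) * solution T (set w j l) ≡⟨ cong₂ (λ u x → u * prob I (set w j l) * x) (unitCost-set w j l) (solution-set A w l) ⟩
    u * prob I (set w j l) * x                                         ≡⟨ cong (λ P → u * P * x) (prob-set {w} e l) ⟩
    u * (pCoord I j (embed l) * prob I w) * x                          ≡⟨ regroup u (pCoord I j (embed l)) (prob I w) x ⟩
    pCoord I j (embed l) * fillTerm T j w                              ∎
    where
    open ≡-Reasoning
    u = unitCost (set w j false)
    x = solution T (set w j false)
    regroup : ∀ u q P x → u * (q * P) * x ≡ q * (u * P * x)
    regroup = solve-∀ ℚ-ring

  lpTerm-star : ∀ T {w j} → lookup w j ≡ ⋆ →
    lpTerm I (solution T) w ≡ c j * (isInW w * prob I w) * testsAlong T j w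
  lpTerm-star T {w} {j} e = begin
    lpTerm I (solution T) w                       ≡⟨ lpTerm-unitCost (solution T) w ⟩
    unitCost w * prob I w * solution T w          ≡⟨ swap (unitCost w) (prob I w) (solution T w) ⟩
    unitCost w * solution T w * prob I w          ≡⟨ cong (_* prob I w) (unitCost*solution T {w} e) ⟩
    c j * (isInW w * testsAlong T j w) * prob I w ≡⟨ regroup (c j) (isInW w) (testsAlong T j w) (prob I w) ⟩
    c j * (isInW w * prob I w) * testsAlong T j w ∎
    where
    open ≡-Reasoning
    swap : ∀ a b x → a * b * x ≡ a * x * b
    swap = solve-∀ ℚ-ring
    regroup : ∀ c i t P → c * (i * t) * P ≡ c * (i * P) * t
    regroup = solve-∀ ℚ-ring

  fiber-avoids : ∀ {j T w} → Avoids j T → lookup w j ≡ ⋆ → fiber (lpTerm I (solution T)) j w ≡ fillTerm T j w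
  fiber-avoids {j} {T} {w} A e = begin
    fiber (lpTerm I (solution T)) j w                          ≡⟨ cong₂ _+_ (lpTerm-fill {w = w} A e false) (cong₂ _+_ (lpTerm-fill {w = w} A e true) unstarred) ⟩
    (1ℚ - p j) * fillTerm T j w + (p j * fillTerm T j w + 0ℚ) ≡⟨ coin (p j) (fillTerm T j w) ⟩
    fillTerm T j w                                             ∎
    where
    open ≡-Reasoning
    unstarred : lpTerm I (solution T) w ≡ 0ℚ
    unstarred = trans (lpTerm-star T {w} e) (trans (cong (c j * (isInW w * prob I w) *_) (testsAlong-avoided A w)) (*-zeroʳ (c j * (isInW w * prob I w))))
    coin : ∀ q F → (1ℚ - q) * F + (q * F + 0ℚ) ≡ F
    coin = solve-∀ ℚ-ring

  fiber-test : ∀ {j T₀ T₁ w} → Avoids j T₀ → Avoids j T₁ → lookup w j ≡ ⋆ →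
    fiber (lpTerm I (solution (test j T₀ T₁))) j w ≡
    (1ℚ - p j) * fillTerm T₀ j w + (p j * fillTerm T₁ j w + c j * (isInW w * prob I w))
  fiber-test {j} {T₀} {T₁} {w} A₀ A₁ e =
    cong₂ _+_ (branch false) (cong₂ _+_ (branch true) tested)
    where
    avoids : ∀ l → Avoids j (if l then T₁ else T₀)
    avoids false = A₀
    avoids true  = A₁
    branch : ∀ l → lpTerm I (solution (test j T₀ T₁)) (set w j l) ≡ pCoord I j (embed l) * fillTerm (if l then T₁ else T₀) j w
    branch l = trans (lpTerm-cong _ _ (set w j l) (solution-test {j} {T₀} {T₁} {set w j l} l (lookup∘update j w (embed l)))) (lpTerm-fill {w = w} (avoids l) e l)
    tested : lpTerm I (solution (test j T₀ T₁)) w ≡ c j * (isInW w * prob I w)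
    tested = trans (lpTerm-star (test j T₀ T₁) {w} e) (trans (cong (c j * (isInW w * prob I w) *_) (testsAlong-self j T₀ T₁ w)) (*-identityʳ (c j * (isInW w * prob I w))))

  Σ⋆-fillTerm : ∀ {j T} → Avoids j T → Σ⋆ j (fillTerm T j) ≡ lpObjective I (solution T)
  Σ⋆-fillTerm {j} {T} A =
    trans (sym (Σ⋆-cong j (λ w → fiber-avoids {w = w} A))) (sym (Σᴾ-split j (lpTerm I (solution T))))

  lpObjective-solution : ∀ {b T} → Valid I b T → lpObjective I (solution T) ≡ expCost I T
  lpObjective-solution (leafV _) =
    Σᴾ-zero (λ w → trans (lpTerm-unitCost (solution leaf) w)
                         (trans (cong (unitCost w * prob I w *_) (solution-leaf w)) (*-zeroʳ (unitCost w * prob I w))))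
  lpObjective-solution {b} (testV {j = j} {T₀} {T₁} _ _ V₀ V₁) = begin
    lpObjective I (solution (test j T₀ T₁))
      ≡⟨ Σᴾ-split j _ ⟩
    Σ⋆ j (fiber (lpTerm I (solution (test j T₀ T₁))) j)
      ≡⟨ Σ⋆-cong j (λ w → fiber-test {w = w} A₀ A₁) ⟩
    Σ⋆ j (λ w → (1ℚ - p j) * fillTerm T₀ j w + (p j * fillTerm T₁ j w + c j * (isInW w * prob I w)))
      ≡⟨ Σ⋆-linear j (1ℚ - p j) (p j) (c j) (fillTerm T₀ j) (fillTerm T₁ j) (λ w → isInW w * prob I w) ⟩
    (1ℚ - p j) * Σ⋆ j (fillTerm T₀ j) + (p j * Σ⋆ j (fillTerm T₁ j) + c j * Σ⋆ j (λ w → isInW w * prob I w))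
      ≡⟨ cong₂ (λ E₀ E₁,₂ → (1ℚ - p j) * E₀ + E₁,₂) (cost A₀ V₀) (cong₂ (λ E₁ M → p j * E₁ + c j * M) (cost A₁ V₁) mass) ⟩
    (1ℚ - p j) * expCost I T₀ + (p j * expCost I T₁ + c j * 1ℚ)
      ≡⟨ regroup (c j) (p j) (expCost I T₀) (expCost I T₁) ⟩
    expCost I (test j T₀ T₁)
      ∎
    where
    open ≡-Reasoning
    A₀ : Avoids j T₀
    A₀ = valid⇒avoids V₀ (embed≢⋆ false ∘ trans (sym (lookup∘update j b t0)))
    A₁ : Avoids j T₁
    A₁ = valid⇒avoids V₁ (embed≢⋆ true ∘ trans (sym (lookup∘update j b t1)))
    cost : ∀ {T b′} → Avoids j T → Valid I b′ T → Σ⋆ j (fillTerm T j) ≡ expCost I T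
    cost A V = trans (Σ⋆-fillTerm A) (lpObjective-solution V)
    mass : Σ⋆ j (λ w → isInW w * prob I w) ≡ 1ℚ
    mass = mass-onlyStar (pCoord I) (λ j → complement (p j)) (λ _ → refl) j
      where
      complement : ∀ q → 1ℚ - q + q ≡ 1ℚ
      complement = solve-∀ ℚ-ring
    regroup : ∀ c q E₀ E₁ → (1ℚ - q) * E₀ + (q * E₁ + c * 1ℚ) ≡ c + (1ℚ - q) * E₀ + q * E₁
    regroup = solve-∀ ℚ-ring

  -- Feasibility

  marginal-∈ : ∀ S b {k} → lookup S k ≡ true → gMarg I S b k ≡ 0ℚ
  marginal-∈ S b Sk =
    trans (cong (λ r → ℕtoℚ (g r) - ℕtoℚ (gS I S b)) (restrict-insert-∈ S b Sk)) (+-inverseʳ (ℕtoℚ (gS I S b)))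

  marginal-antitone : ∀ S a j k → k ≢ j → gMarg I (insert S j) (total a) k ≤ gMarg I S (total a) k
  marginal-antitone S a j k k≢j with lookup S k in Sk
  ... | true  = ≤-reflexive (trans (marginal-∈ (insert S j) A S′k) (sym (marginal-∈ S A Sk)))
    where
    A = total a
    S′k : lookup (insert S j) k ≡ true
    S′k = trans (lookup∘update′ k≢j S true) Sk
  ... | false = p+s≤r+q⇒p-q≤r-s {ℕtoℚ (g (restrict (insert (insert S j) k) A))} {ℕtoℚ (g b′)}
                                   {ℕtoℚ (g (restrict (insert S k) A))} {ℕtoℚ (g b)}
                  (subst₂ _≤_ (ℕtoℚ-+ (g (restrict (insert (insert S j) k) A)) (g b)) (ℕtoℚ-+ (g (restrict (insert S k) A)) (g b′))
                          (ℕtoℚ-mono-≤ submodular-step))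
    where
    A = total a
    b = restrict S A
    b′ = restrict (insert S j) A
    submodular-step : g (restrict (insert (insert S j) k) A) ℕ.+ g b ℕ.≤ g (restrict (insert S k) A) ℕ.+ g b′
    submodular-step =
      subst₂ (λ u v → g u ℕ.+ g b ℕ.≤ g v ℕ.+ g b′)
        (sym (restrict-insert-total (insert S j) a k)) (sym (restrict-insert-total S a k))
        (submodular b b′ k (lookup a k) (restrict-insert-extends S A j)
          (lookup-restrict-∉ {S = S} A Sk) (lookup-restrict-∉ {S = insert S j} A (trans (lookup∘update′ k≢j S true) Sk)))

  ConstraintHolds : Tree I → Vec Bool n → Vec Bool n → Set
  ConstraintHolds T a S = ℕtoℚ Q - ℕtoℚ (gS I S (total a)) ≤ sumFin n (λ k → gMarg I S (total a) k * solution T (hole a k))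

  constraint-test : ∀ {j T₀ T₁} l a S → lookup a j ≡ l →
    ConstraintHolds (if l then T₁ else T₀) a (insert S j) → ConstraintHolds (test j T₀ T₁) a S
  constraint-test {j} {T₀} {T₁} l a S aj IH = begin
    ℕtoℚ Q - ℕtoℚ (gS I S A)                                             ≡⟨ telescope (ℕtoℚ Q) (ℕtoℚ (gS I S A)) (ℕtoℚ (gS I (insert S j) A)) ⟩
    ℕtoℚ Q - ℕtoℚ (gS I (insert S j) A) + gMarg I S A j                  ≤⟨ +-monoˡ-≤ (gMarg I S A j) IH ⟩
    sumFin n (λ k → gMarg I (insert S j) A k * solution Tₗ (hole a k)) + gMarg I S A j
                                                                          ≤⟨ sumFin-mono-+ n j (gMarg I S A j) at-j off-j ⟩
    sumFin n (λ k → gMarg I S A k * solution (test j T₀ T₁) (hole a k))  ∎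
    where
    open ≤-Reasoning
    A = total a
    Tₗ = if l then T₁ else T₀
    telescope : ∀ q x y → q - x ≡ q - y + (y - x)
    telescope = solve-∀ ℚ-ring
    at-j : gMarg I (insert S j) A j * solution Tₗ (hole a j) + gMarg I S A j ≤ gMarg I S A j * solution (test j T₀ T₁) (hole a j)
    at-j = ≤-reflexive (begin-equality
      gMarg I (insert S j) A j * solution Tₗ (hole a j) + gMarg I S A j
        ≡⟨ cong (λ m → m * solution Tₗ (hole a j) + gMarg I S A j) (marginal-∈ (insert S j) A (lookup∘update j S true)) ⟩
      0ℚ * solution Tₗ (hole a j) + gMarg I S A j
        ≡⟨ cong (_+ gMarg I S A j) (*-zeroˡ (solution Tₗ (hole a j))) ⟩
      0ℚ + gMarg I S A j
        ≡⟨ trans (+-identityˡ (gMarg I S A j)) (sym (*-identityʳ (gMarg I S A j))) ⟩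
      gMarg I S A j * 1ℚ
        ≡⟨ cong (gMarg I S A j *_) (solution-hole j T₀ T₁ a) ⟨
      gMarg I S A j * solution (test j T₀ T₁) (hole a j) ∎)
    off-j : ∀ k → k ≢ j → gMarg I (insert S j) A k * solution Tₗ (hole a k) ≤ gMarg I S A k * solution (test j T₀ T₁) (hole a k)
    off-j k k≢j = begin
      gMarg I (insert S j) A k * solution Tₗ (hole a k) ≤⟨ *-monoʳ-≤-nonNeg (solution Tₗ (hole a k)) {{nonNegative (solution-nonNeg Tₗ (hole a k))}} (marginal-antitone S a j k k≢j) ⟩
      gMarg I S A k * solution Tₗ (hole a k)            ≡⟨ cong (gMarg I S A k *_) (solution-test {j} {T₀} {T₁} {hole a k} l (trans (lookup-hole a (k≢j ∘ sym)) (cong embed aj))) ⟨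
      gMarg I S A k * solution (test j T₀ T₁) (hole a k) ∎

  solution-feasible : ∀ {b T} → Valid I b T → ∀ a S → b ⊑ restrict S (total a) → ConstraintHolds T a S
  solution-feasible (leafV gb≡Q) a S b⊑ = begin
    ℕtoℚ Q - ℕtoℚ (gS I S (total a))  ≤⟨ p≤q⇒p-q≤0 (ℕtoℚ-mono-≤ (subst (ℕ._≤ gS I S (total a)) gb≡Q (monotone-⊑ {n} g monotone b⊑))) ⟩
    0ℚ                                ≡⟨ sumFin-zero n (λ k → trans (cong (gMarg I S (total a) k *_) (solution-leaf (hole a k))) (*-zeroʳ (gMarg I S (total a) k))) ⟨
    sumFin n (λ k → gMarg I S (total a) k * solution leaf (hole a k)) ∎
    where open ≤-Reasoning
  solution-feasible (testV {j = j} _ _ V₀ V₁) a S b⊑ with lookup a j in aj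
  ... | false = constraint-test false a S aj (solution-feasible V₀ a (insert S j) (⊑-branch b⊑ aj))
  ... | true  = constraint-test true  a S aj (solution-feasible V₁ a (insert S j) (⊑-branch b⊑ aj))

lemma3 : ∀ {n : ℕ} (I : SSSC n) (T : Tree I) → Valid I (allStar n) T →
           Σ (PAssign n → ℚ) (λ x → LPFeasible I x × lpObjective I x ≤ expCost I T)
lemma3 I T V =
  solution I T ,
  ((λ a S → solution-feasible I V a S (allStar-⊑ _)) , (λ w _ → solution-nonNeg I T w)) ,
  ≤-reflexive (lpObjective-solution I V)
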